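{- For every $n \in \mathbb{N} = \{1,2,3,\dots\}$ and every union-closed family $\mathcal{F}$ with $|\bigcup \mathcal{F}| = n$, \[ D(\mathcal{F}) \geq \frac{\log_2 n}{2n}. \] Equivalently, $s_n \geq \frac{\log_2 n}{2n}$ for all $n \in \mathbb{N}$.
   Context: A union-closed family is a finite family $\mathcal{F}$ of finite sets such that $A \cup B \in \mathcal{F}$ for all $A, B \in \mathcal{F}$. Write $\bigcup \mathcal{F} := \bigcup_{A \in \mathcal{F}} A$ and, for $a \in \bigcup \mathcal{F}$, $\mathcal{F}_a := \{S \in \mathcal{F} : a \in S\}$. For a union-closed family with $n = |\bigcup\mathcal{F}| \geq 1$, its density is \[ D(\mathcal{F}) := \frac{1}{n|\mathcal{F}|} \sum_{A \in \mathcal{F}} |A| = \frac{1}{n|\mathcal{F}|}\sum_{a \in \bigcup\mathcal{F}} |\mathcal{F}_a|, \] and $s_n$ denotes the minimum of $D(\mathcal{F})$ over all union-closed families $\mathcal{F}$ with $|\bigcup\mathcal{F}| = n$. -}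

module Defs where

open import Data.Nat using (ℕ; _+_)
open import Data.List using (List; []; _∷_; length)
open import Data.Fin.Subset using (Subset; _∪_; ⋃; ∣_∣)
open import Data.List.Membership.Propositional using (_∈_)
open import Data.List.Relation.Unary.Unique.Propositional using (Unique)
open import Data.Product using (_×_)

-- A finite family of finite sets, all contained in an ambient finite set Fin m,
-- represented as a duplicate-free list of subsets.
-- Union-closed: A ∪ B ∈ F for all A, B ∈ F.
UnionClosed : ∀ {m} → List (Subset m) → Set
UnionClosed {m} F = Unique F × (∀ {A B : Subset m} → A ∈ F → B ∈ F → (A ∪ B) ∈ F)

bigUnion : ∀ {m} → List (Subset m) → Subset m
bigUnion = ⋃

totalSize : ∀ {m} → List (Subset m) → ℕ
totalSize [] = 0
totalSize (A ∷ F) = ∣ A ∣ + totalSize F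

{-# OPTIONS --safe #-}
-- Call x, y ∈ ⋃ F equivalent when the same members of F contain them, and let X hold one element of
-- each class: then |X| ≤ |F|, and every strict inclusion A ⊂ C in F is witnessed by an element of X.
-- Attach to A ∈ F the subcube of sets S with A ∩ X ⊆ S that avoid the elements of X gained in the
-- covers of A within F. These |F| subcubes are pairwise disjoint, so Kraft's inequality and AM–GM
-- bound their total codimension ∑ (|A ∩ X| + |gained A|) below by |F| log₂ |F|. Sending A to a cover
-- containing a gained y is injective, hence ∑ |gained A| ≤ ∑ |A ∩ X| and |F| log₂ |F| ≤ 2 ∑ |A ∩ X|.
-- Finally n ≤ |X| + |⋃ F ∖ X| ≤ |F| + ∑ |A ∖ X|, and (|F| + t)^|F| ≤ |F|^|F| 4^t.
module Submission where

open import Defs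
open import Data.Nat using (ℕ; _*_; _^_; _≤_)
open import Data.List using (List; length)
open import Data.Fin.Subset using (Subset; ∣_∣)
open import Relation.Binary.PropositionalEquality using (_≡_)

open import Data.Bool using (true; false)
open import Data.Bool.Properties using (T-≡) renaming (_≟_ to _≟ᵇ_)
open import Data.Empty using (⊥-elim)
open import Data.Fin using (Fin; Fin′; zero; suc; toℕ; fromℕ<; inject)
open import Data.Fin.Properties
  using (toℕ-injective; toℕ-inject; toℕ-fromℕ<; ¬∀⟶∃¬; ¬∀⟶∃¬-smallest)
  renaming (all? to allFin?)
open import Data.Fin.Subset using (_∈_; _∉_; _⊆_; _⊂_; _∪_; _∩_; ⋃; ∁) renaming (⊥ to ∅)
open import Data.Fin.Subset.Induction using (⊂-wellFounded)
open import Data.Fin.Subset.Properties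
  using (_∈?_; _⊆?_; _⊂?_; ⊆-refl; ⊆-reflexive; ⊆-trans; ⊆-antisym; p⊆p∪q; q⊆p∪q; x∈p∪q⁺; x∈p∪q⁻;
         x∈p∩q⁺; x∈p∩q⁻; ∉⊥; ∣p∩q∣≤∣q∣; ∣p∣≤n; ∪-identityʳ; drop-there)
open import Data.List using ([]; _∷_; _++_; map; filter; replicate; tabulate; allFin)
open import Data.List.Membership.Propositional using (find; lose) renaming (_∈_ to _∈ₗ_)
open import Data.List.Membership.Propositional.Properties using (∈-filter⁺; ∈-filter⁻)
open import Data.List.Properties
  using (length-map; length-++; length-replicate; length-removeAt′; map-∘; map-cong; filter-≐; filter-notAll)
open import Data.List.Relation.Unary.All as All using (All; []; _∷_; all?)
open import Data.List.Relation.Unary.All.Properties using () renaming (map⁺ to All-map⁺)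
open import Data.List.Relation.Unary.AllPairs using (AllPairs; []; _∷_)
open import Data.List.Relation.Unary.AllPairs.Properties using () renaming (map⁺ to AllPairs-map⁺)
open import Data.List.Relation.Unary.Any using (here; there; any?; _─_; index)
open import Data.List.Relation.Unary.Unique.Propositional using (Unique)
open import Data.List.Relation.Unary.Unique.Propositional.Properties using (filter⁺; allFin⁺)
open import Data.Nat using (zero; suc; _+_; _∸_; _<_; z≤n; s≤s; NonZero)
open import Data.Nat.ListAction using (sum; product)
open import Data.Nat.ListAction.Properties using (sum-++; product-++)
open import Data.Nat.Properties
open import Data.Nat.Tactic.RingSolver using (solve-∀)
open import Data.Product using (_×_; _,_; ∃; ∃₂; proj₁; proj₂)
open import Data.Sum using (_⊎_; inj₁; inj₂; [_,_]′)
open import Data.Vec as Vec using ([]; _∷_; here; there; tail)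
open import Data.Vec.Properties using (≡-dec; lookup∘tabulate; []=⇒lookup; lookup⇒[]=)
open import Function using (_∘_; id; flip; Equivalence)
open import Induction.WellFounded using (Acc; acc)
open import Relation.Binary using (DecidableEquality; tri<; tri≈; tri>)
open import Relation.Binary.PropositionalEquality using (refl; sym; trans; cong; cong₂; subst; subst₂; _≢_; module ≡-Reasoning)
open import Relation.Nullary using (¬_; Dec; yes; no; isYes; ¬?; _×-dec_; _→-dec_; contradiction)
open import Relation.Nullary.Decidable using (toWitness; fromWitness; decidable-stable)
open import Relation.Unary using (Decidable)

open import Algebra.Properties.CommutativeSemigroup +-commutativeSemigroup
  using () renaming (interchange to +-interchange; x∙yz≈y∙xz to +-leftComm)
open import Algebra.Properties.CommutativeSemigroup *-commutativeSemigroup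
  using () renaming (interchange to *-interchange)

sum-map-+ : ∀ {A : Set} (f g : A → ℕ) (xs : List A) →
            sum (map (λ x → f x + g x) xs) ≡ sum (map f xs) + sum (map g xs)
sum-map-+ f g []       = refl
sum-map-+ f g (x ∷ xs) = trans (cong (f x + g x +_) (sum-map-+ f g xs)) (+-interchange (f x) (g x) _ _)

sum-map-mono-≤ : ∀ {A : Set} {f g : A → ℕ} (xs : List A) → (∀ x → f x ≤ g x) → sum (map f xs) ≤ sum (map g xs)
sum-map-mono-≤ []       f≤g = z≤n
sum-map-mono-≤ (x ∷ xs) f≤g = +-mono-≤ (f≤g x) (sum-map-mono-≤ xs f≤g)

∈⇒≤sum-map : ∀ {A : Set} (f : A → ℕ) {x : A} {xs : List A} → x ∈ₗ xs → f x ≤ sum (map f xs)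
∈⇒≤sum-map f (here refl)              = m≤m+n _ _
∈⇒≤sum-map f {xs = y ∷ _} (there x∈xs) = ≤-trans (∈⇒≤sum-map f x∈xs) (m≤n+m _ (f y))

sum-map-const : ∀ {A : Set} {f : A → ℕ} {c : ℕ} {xs : List A} → All (λ x → f x ≡ c) xs → sum (map f xs) ≡ length xs * c
sum-map-const []             = refl
sum-map-const (fx≡c ∷ fxs≡c) = cong₂ _+_ fx≡c (sum-map-const fxs≡c)

sum-map-*ˡ : ∀ c (xs : List ℕ) → sum (map (c *_) xs) ≡ c * sum xs
sum-map-*ˡ c []       = sym (*-zeroʳ c)
sum-map-*ˡ c (x ∷ xs) = trans (cong (c * x +_) (sum-map-*ˡ c xs)) (sym (*-distribˡ-+ c x (sum xs)))

product-map-*ˡ : ∀ c (xs : List ℕ) → product (map (c *_) xs) ≡ c ^ length xs * product xs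
product-map-*ˡ c []       = refl
product-map-*ˡ c (x ∷ xs) = trans (cong (c * x *_) (product-map-*ˡ c xs)) (*-interchange c x _ _)

product-map-^ : ∀ {A : Set} b (f : A → ℕ) (xs : List A) → product (map (λ x → b ^ f x) xs) ≡ b ^ sum (map f xs)
product-map-^ b f []       = refl
product-map-^ b f (x ∷ xs) = trans (cong (b ^ f x *_) (product-map-^ b f xs)) (sym (^-distribˡ-+-* b (f x) _))

sum-replicate : ∀ k x → sum (replicate k x) ≡ k * x
sum-replicate zero    x = refl
sum-replicate (suc k) x = cong (x +_) (sum-replicate k x)

product-replicate : ∀ k x → product (replicate k x) ≡ x ^ k
product-replicate zero    x = refl
product-replicate (suc k) x = cong (x *_) (product-replicate k x)

sum≡0⇒product≡0 : ∀ x xs → sum (x ∷ xs) ≡ 0 → product (x ∷ xs) ≡ 0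
sum≡0⇒product≡0 zero xs _ = refl

splitAt-length : ∀ {A : Set} k {l} (xs : List A) → length xs ≡ k + l →
                 ∃₂ λ ys zs → ys ++ zs ≡ xs × length ys ≡ k × length zs ≡ l
splitAt-length zero    xs       eq = [] , xs , refl , refl , eq
splitAt-length (suc k) (x ∷ xs) eq with splitAt-length k xs (suc-injective eq)
... | ys , zs , refl , refl , refl = x ∷ ys , zs , refl , refl , refl

-- AM–GM over ℕ

^-distribʳ-* : ∀ m n o → (m * n) ^ o ≡ m ^ o * n ^ o
^-distribʳ-* m n zero    = refl
^-distribʳ-* m n (suc o) = trans (cong (m * n *_) (^-distribʳ-* m n o)) (*-interchange m n (m ^ o) (n ^ o))

n≤2^n : ∀ n → n ≤ 2 ^ n
n≤2^n zero    = z≤n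
n≤2^n (suc n) = ≤-trans (+-mono-≤ (m^n>0 2 n) (n≤2^n n)) (≤-reflexive (cong (2 ^ n +_) (sym (+-identityʳ (2 ^ n)))))

m≤n⇒4*[m*n]≤[m+n]^2 : ∀ {m n} → m ≤ n → 4 * (m * n) ≤ (m + n) ^ 2
m≤n⇒4*[m*n]≤[m+n]^2 {m} {n} m≤n = subst (λ k → 4 * (m * k) ≤ (m + k) ^ 2) (m+[n∸m]≡n m≤n)
  (≤-trans (m≤m+n _ ((n ∸ m) * (n ∸ m))) (≤-reflexive (square m (n ∸ m))))
  where
  -- _ ^ 2 is spelled out for the ring solver
  square : ∀ a d → 4 * (a * (a + d)) + d * d ≡ (a + (a + d)) * ((a + (a + d)) * 1)
  square = solve-∀

4*[m*n]≤[m+n]^2 : ∀ m n → 4 * (m * n) ≤ (m + n) ^ 2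
4*[m*n]≤[m+n]^2 m n with ≤-total m n
... | inj₁ m≤n = m≤n⇒4*[m*n]≤[m+n]^2 m≤n
... | inj₂ n≤m = subst₂ _≤_ (cong (4 *_) (*-comm n m)) (cong (_^ 2) (+-comm n m)) (m≤n⇒4*[m*n]≤[m+n]^2 n≤m)

[2*m]^[2*m]≡4^m*[m^m*m^m] : ∀ m → (2 * m) ^ (2 * m) ≡ 4 ^ m * (m ^ m * m ^ m)
[2*m]^[2*m]≡4^m*[m^m*m^m] m = begin
  (2 * m) ^ (2 * m)        ≡⟨ sym (^-*-assoc (2 * m) 2 m) ⟩
  ((2 * m) ^ 2) ^ m        ≡⟨ cong (_^ m) (square m) ⟩
  (4 * (m * m)) ^ m        ≡⟨ ^-distribʳ-* 4 (m * m) m ⟩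
  4 ^ m * (m * m) ^ m      ≡⟨ cong (4 ^ m *_) (^-distribʳ-* m m m) ⟩
  4 ^ m * (m ^ m * m ^ m)  ∎
  where
  open ≡-Reasoning
  square : ∀ a → (2 * a) * ((2 * a) * 1) ≡ 4 * (a * a)
  square = solve-∀

amgm-double : ∀ k {a b s t} → k ^ k * a ≤ s ^ k → k ^ k * b ≤ t ^ k →
              (2 * k) ^ (2 * k) * (a * b) ≤ (s + t) ^ (2 * k)
amgm-double k {a} {b} {s} {t} ka≤s^k kb≤t^k = begin
  (2 * k) ^ (2 * k) * (a * b)          ≡⟨ cong (_* (a * b)) ([2*m]^[2*m]≡4^m*[m^m*m^m] k) ⟩
  4 ^ k * (k ^ k * k ^ k) * (a * b)    ≡⟨ *-assoc (4 ^ k) _ _ ⟩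
  4 ^ k * (k ^ k * k ^ k * (a * b))    ≡⟨ cong (4 ^ k *_) (*-interchange (k ^ k) (k ^ k) a b) ⟩
  4 ^ k * (k ^ k * a * (k ^ k * b))    ≤⟨ *-monoʳ-≤ (4 ^ k) (*-mono-≤ ka≤s^k kb≤t^k) ⟩
  4 ^ k * (s ^ k * t ^ k)              ≡⟨ cong (4 ^ k *_) (sym (^-distribʳ-* s t k)) ⟩
  4 ^ k * (s * t) ^ k                  ≡⟨ sym (^-distribʳ-* 4 (s * t) k) ⟩
  (4 * (s * t)) ^ k                    ≤⟨ ^-monoˡ-≤ k (4*[m*n]≤[m+n]^2 s t) ⟩
  ((s + t) ^ 2) ^ k                    ≡⟨ ^-*-assoc (s + t) 2 k ⟩
  (s + t) ^ (2 * k)                    ∎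
  where open ≤-Reasoning

amgm-2^ : ∀ r (xs : List ℕ) → length xs ≡ 2 ^ r → (2 ^ r) ^ (2 ^ r) * product xs ≤ sum xs ^ (2 ^ r)
amgm-2^ zero    (x ∷ []) _ = ≤-reflexive (single x)
  where
  single : ∀ x → 1 * (x * 1) ≡ (x + 0) * 1
  single = solve-∀
amgm-2^ (suc r) xs length≡ with splitAt-length (2 ^ r) xs length≡
... | ys , zs , refl , length-ys , length-zs
  rewrite product-++ ys zs | sum-++ ys zs =
  amgm-double (2 ^ r) (amgm-2^ r ys length-ys) (amgm-2^ r zs (trans length-zs (+-identityʳ (2 ^ r))))

amgm-nonzero : ∀ (xs : List ℕ) T .{{_ : NonZero T}} → sum xs ≡ T →
               length xs ^ length xs * product xs ≤ T ^ length xs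
amgm-nonzero xs T sum≡T =
  *-cancelʳ-≤ _ _ (T ^ (K ∸ N)) {{m^n≢0 T (K ∸ N)}} (*-cancelˡ-≤ (K ^ K) {{m^n≢0 K K {{m^n≢0 2 N}}}} (begin
    K ^ K * (N ^ N * product xs * T ^ (K ∸ N))  ≡⟨ cong (K ^ K *_) (sym product-ys) ⟩
    K ^ K * product ys                          ≤⟨ amgm-2^ N ys length-ys ⟩
    sum ys ^ K                                  ≡⟨ cong (_^ K) sum-ys ⟩
    (K * T) ^ K                                 ≡⟨ ^-distribʳ-* K T K ⟩
    K ^ K * T ^ K                               ≡⟨ cong (λ k → K ^ K * T ^ k) (sym (m+[n∸m]≡n N≤K)) ⟩
    K ^ K * T ^ (N + (K ∸ N))                   ≡⟨ cong (K ^ K *_) (^-distribˡ-+-* T N (K ∸ N)) ⟩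
    K ^ K * (T ^ N * T ^ (K ∸ N))               ∎))
  where
  open ≤-Reasoning
  N K : ℕ
  N = length xs
  K = 2 ^ N
  N≤K : N ≤ K
  N≤K = n≤2^n N
  -- scaled by N and padded with copies of T: 2 ^ N numbers of mean T
  ys : List ℕ
  ys = map (N *_) xs ++ replicate (K ∸ N) T
  length-ys : length ys ≡ K
  length-ys = begin-equality
    length ys                                         ≡⟨ length-++ (map (N *_) xs) ⟩
    length (map (N *_) xs) + length (replicate (K ∸ N) T) ≡⟨ cong₂ _+_ (length-map (N *_) xs) (length-replicate (K ∸ N)) ⟩
    N + (K ∸ N)                                       ≡⟨ m+[n∸m]≡n N≤K ⟩
    K                                                 ∎
  sum-ys : sum ys ≡ K * T
  sum-ys = begin-equality
    sum ys                                            ≡⟨ sum-++ (map (N *_) xs) _ ⟩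
    sum (map (N *_) xs) + sum (replicate (K ∸ N) T)   ≡⟨ cong₂ _+_ (trans (sum-map-*ˡ N xs) (cong (N *_) sum≡T)) (sum-replicate (K ∸ N) T) ⟩
    N * T + (K ∸ N) * T                               ≡⟨ sym (*-distribʳ-+ T N (K ∸ N)) ⟩
    (N + (K ∸ N)) * T                                 ≡⟨ cong (_* T) (m+[n∸m]≡n N≤K) ⟩
    K * T                                             ∎
  product-ys : product ys ≡ N ^ N * product xs * T ^ (K ∸ N)
  product-ys = trans (product-++ (map (N *_) xs) _) (cong₂ _*_ (product-map-*ˡ N xs) (product-replicate (K ∸ N) T))

amgm : ∀ (xs : List ℕ) → length xs ^ length xs * product xs ≤ sum xs ^ length xs
amgm []             = ≤-refl
amgm xs@(x ∷ xs′) with sum xs in sum≡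
... | zero  = ≤-reflexive (trans (cong (N ^ N *_) (sum≡0⇒product≡0 x xs′ sum≡)) (*-zeroʳ (N ^ N)))
  where
  N : ℕ
  N = length xs
... | suc T = amgm-nonzero xs (suc T) sum≡

amgm-map : ∀ {A : Set} (f : A → ℕ) (xs : List A) →
           length xs ^ length xs * product (map f xs) ≤ sum (map f xs) ^ length xs
amgm-map f xs = subst (λ k → k ^ k * product (map f xs) ≤ sum (map f xs) ^ k) (length-map f xs) (amgm (map f xs))

product≤mean^length : ∀ (xs : List ℕ) a → sum xs ≡ length xs * a → product xs ≤ a ^ length xs
product≤mean^length []            a _     = ≤-refl
product≤mean^length xs@(_ ∷ _) a sum≡ = *-cancelˡ-≤ (N ^ N) {{m^n≢0 N N}} (begin
  N ^ N * product xs  ≤⟨ amgm xs ⟩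
  sum xs ^ N          ≡⟨ cong (_^ N) sum≡ ⟩
  (N * a) ^ N         ≡⟨ ^-distribʳ-* N a N ⟩
  N ^ N * a ^ N       ∎)
  where
  open ≤-Reasoning
  N : ℕ
  N = length xs

[m+n]^m≤m^m*4^n : ∀ m n → (m + n) ^ m ≤ m ^ m * 4 ^ n
[m+n]^m≤m^m*4^n zero      n = ≤-trans (m^n>0 4 n) (≤-reflexive (sym (*-identityˡ (4 ^ n))))
[m+n]^m≤m^m*4^n m@(suc _) n = *-cancelˡ-≤ (2 ^ m * m ^ (2 * n)) {{m*n≢0 _ _ {{m^n≢0 2 m}} {{m^n≢0 m (2 * n)}}}} (begin
  2 ^ m * m ^ (2 * n) * (m + n) ^ m          ≡⟨ sym product-zs ⟩
  product zs                                 ≤⟨ product≤mean^length zs (2 * m) sum-zs ⟩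
  (2 * m) ^ length zs                        ≡⟨ cong ((2 * m) ^_) length-zs ⟩
  (2 * m) ^ (m + 2 * n)                      ≡⟨ ^-distribʳ-* 2 m (m + 2 * n) ⟩
  2 ^ (m + 2 * n) * m ^ (m + 2 * n)          ≡⟨ cong₂ _*_ (^-distribˡ-+-* 2 m (2 * n)) (^-distribˡ-+-* m m (2 * n)) ⟩
  2 ^ m * 2 ^ (2 * n) * (m ^ m * m ^ (2 * n)) ≡⟨ cong (λ k → 2 ^ m * k * (m ^ m * m ^ (2 * n))) (sym (^-*-assoc 2 2 n)) ⟩
  2 ^ m * 4 ^ n * (m ^ m * m ^ (2 * n))      ≡⟨ regroup (2 ^ m) (4 ^ n) (m ^ m) (m ^ (2 * n)) ⟩
  2 ^ m * m ^ (2 * n) * (m ^ m * 4 ^ n)      ∎)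
  where
  open ≤-Reasoning
  -- m copies of 2 (m + n) and 2 n copies of m have mean 2 m
  zs : List ℕ
  zs = replicate m (2 * (m + n)) ++ replicate (2 * n) m
  length-zs : length zs ≡ m + 2 * n
  length-zs = trans (length-++ (replicate m (2 * (m + n)))) (cong₂ _+_ (length-replicate m) (length-replicate (2 * n)))
  sum-zs : sum zs ≡ length zs * (2 * m)
  sum-zs = begin-equality
    sum zs                                  ≡⟨ sum-++ (replicate m (2 * (m + n))) _ ⟩
    sum (replicate m (2 * (m + n))) + sum (replicate (2 * n) m) ≡⟨ cong₂ _+_ (sum-replicate m (2 * (m + n))) (sum-replicate (2 * n) m) ⟩
    m * (2 * (m + n)) + 2 * n * m           ≡⟨ mean m n ⟩
    (m + 2 * n) * (2 * m)                   ≡⟨ cong (_* (2 * m)) (sym length-zs) ⟩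
    length zs * (2 * m)                     ∎
    where
    mean : ∀ a b → a * (2 * (a + b)) + 2 * b * a ≡ (a + 2 * b) * (2 * a)
    mean = solve-∀
  product-zs : product zs ≡ 2 ^ m * m ^ (2 * n) * (m + n) ^ m
  product-zs = begin-equality
    product zs                                         ≡⟨ product-++ (replicate m (2 * (m + n))) _ ⟩
    product (replicate m (2 * (m + n))) * product (replicate (2 * n) m) ≡⟨ cong₂ _*_ (product-replicate m (2 * (m + n))) (product-replicate (2 * n) m) ⟩
    (2 * (m + n)) ^ m * m ^ (2 * n)                    ≡⟨ cong (_* m ^ (2 * n)) (^-distribʳ-* 2 (m + n) m) ⟩
    2 ^ m * (m + n) ^ m * m ^ (2 * n)                  ≡⟨ swap (2 ^ m) ((m + n) ^ m) (m ^ (2 * n)) ⟩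
    2 ^ m * m ^ (2 * n) * (m + n) ^ m                  ∎
    where
    swap : ∀ a b c → a * b * c ≡ a * c * b
    swap = solve-∀
  regroup : ∀ a b c d → a * b * (c * d) ≡ a * d * (c * b)
  regroup = solve-∀

∈-─⁺ : ∀ {A : Set} {x y : A} {ys : List A} (y∈ys : y ∈ₗ ys) → x ∈ₗ ys → x ≢ y → x ∈ₗ (ys ─ y∈ys)
∈-─⁺ (here refl)  (here refl)  x≢y = ⊥-elim (x≢y refl)
∈-─⁺ (here refl)  (there x∈ys) _   = x∈ys
∈-─⁺ (there y∈ys) (here refl)  _   = here refl
∈-─⁺ (there y∈ys) (there x∈ys) x≢y = there (∈-─⁺ y∈ys x∈ys x≢y)

length-≤-injection : ∀ {A B : Set} {xs : List A} (ys : List B) (f : A → B) → Unique xs →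
                     (∀ {x} → x ∈ₗ xs → f x ∈ₗ ys) →
                     (∀ {x x′} → x ∈ₗ xs → x′ ∈ₗ xs → f x ≡ f x′ → x ≡ x′) →
                     length xs ≤ length ys
length-≤-injection {xs = []}     ys f _                maps-to injective = z≤n
length-≤-injection {xs = x ∷ xs} ys f (x∉xs ∷ unique) maps-to injective =
  ≤-trans (s≤s (length-≤-injection (ys ─ fx∈ys) f unique maps-to′ (λ p q → injective (there p) (there q))))
          (≤-reflexive (sym (length-removeAt′ ys (index fx∈ys))))
  where
  fx∈ys : f x ∈ₗ ys
  fx∈ys = maps-to (here refl)
  maps-to′ : ∀ {x′} → x′ ∈ₗ xs → f x′ ∈ₗ (ys ─ fx∈ys)
  maps-to′ x′∈xs = ∈-─⁺ fx∈ys (maps-to (there x′∈xs))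
                     (λ fx′≡fx → All.lookup x∉xs x′∈xs (sym (injective (there x′∈xs) (here refl) fx′≡fx)))

AllPairs-mapWith∈ : ∀ {A : Set} {R S : A → A → Set} {xs : List A} →
                    (∀ {x y} → x ∈ₗ xs → y ∈ₗ xs → R x y → S x y) → AllPairs R xs → AllPairs S xs
AllPairs-mapWith∈ R⇒S []           = []
AllPairs-mapWith∈ R⇒S (Rx ∷ Rxs) =
  All.tabulate (λ y∈xs → R⇒S (here refl) (there y∈xs) (All.lookup Rx y∈xs)) ∷
  AllPairs-mapWith∈ (λ x∈xs y∈xs → R⇒S (there x∈xs) (there y∈xs)) Rxs

fromPred : ∀ {n} {P : Fin n → Set} → Decidable P → Subset n
fromPred P? = Vec.tabulate (λ x → isYes (P? x))

∈fromPred⁻ : ∀ {n} {P : Fin n → Set} (P? : Decidable P) {x} → x ∈ fromPred P? → P x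
∈fromPred⁻ P? {x} x∈ = toWitness {a? = P? x} (Equivalence.from T-≡ (trans (sym (lookup∘tabulate _ x)) ([]=⇒lookup x∈)))

∈fromPred⁺ : ∀ {n} {P : Fin n → Set} (P? : Decidable P) {x} → P x → x ∈ fromPred P?
∈fromPred⁺ P? {x} Px = lookup⇒[]= x _ (trans (lookup∘tabulate _ x) (Equivalence.to T-≡ (fromWitness {a? = P? x} Px)))

∣p∣≡length-filter-tabulate : ∀ {A : Set} {P : A → Set} (P? : Decidable P) {n} (p : Subset n) (g : Fin n → A) →
                             (∀ i → i ∈ p → P (g i)) → (∀ i → P (g i) → i ∈ p) →
                             ∣ p ∣ ≡ length (filter P? (tabulate g))
∣p∣≡length-filter-tabulate P? []          g _  _    = refl
∣p∣≡length-filter-tabulate P? (true ∷ p)  g to from with P? (g zero)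
... | yes _     = cong suc (∣p∣≡length-filter-tabulate P? p (g ∘ suc) (λ i → to (suc i) ∘ there) (λ i → drop-there ∘ from (suc i)))
... | no ¬P[g0] = contradiction (to zero here) ¬P[g0]
∣p∣≡length-filter-tabulate P? (false ∷ p) g to from with P? (g zero)
... | yes P[g0] = contradiction (from zero P[g0]) λ ()
... | no _      = ∣p∣≡length-filter-tabulate P? p (g ∘ suc) (λ i → to (suc i) ∘ there) (λ i → drop-there ∘ from (suc i))

∣p∣≡length-filter-allFin : ∀ {n} (p : Subset n) → ∣ p ∣ ≡ length (filter (_∈? p) (allFin n))
∣p∣≡length-filter-allFin p = ∣p∣≡length-filter-tabulate (_∈? p) p id (λ _ → id) (λ _ → id)

∣p∣≡∣p∩q∣+∣p∩∁q∣ : ∀ {n} (p q : Subset n) → ∣ p ∣ ≡ ∣ p ∩ q ∣ + ∣ p ∩ ∁ q ∣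
∣p∣≡∣p∩q∣+∣p∩∁q∣ []          []          = refl
∣p∣≡∣p∩q∣+∣p∩∁q∣ (true ∷ p)  (true ∷ q)  = cong suc (∣p∣≡∣p∩q∣+∣p∩∁q∣ p q)
∣p∣≡∣p∩q∣+∣p∩∁q∣ (true ∷ p)  (false ∷ q) = trans (cong suc (∣p∣≡∣p∩q∣+∣p∩∁q∣ p q)) (sym (+-suc _ _))
∣p∣≡∣p∩q∣+∣p∩∁q∣ (false ∷ p) (_ ∷ q)     = ∣p∣≡∣p∩q∣+∣p∩∁q∣ p q

∑∣∣≡∑∣∩∣+∑∣∩∁∣ : ∀ {n} (q : Subset n) (F : List (Subset n)) →
                 sum (map ∣_∣ F) ≡ sum (map (λ A → ∣ A ∩ q ∣) F) + sum (map (λ A → ∣ A ∩ ∁ q ∣) F)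
∑∣∣≡∑∣∩∣+∑∣∩∁∣ q F = trans (cong sum (map-cong (λ A → ∣p∣≡∣p∩q∣+∣p∩∁q∣ A q) F)) (sum-map-+ _ _ F)

occurrences : ∀ {T : Set} {n} → Fin n → (T → Subset n) → List T → ℕ
occurrences i f xs = length (filter (λ x → i ∈? f x) xs)

occurrences-suc : ∀ {T : Set} {n} (i : Fin n) (f : T → Subset (suc n)) (xs : List T) →
                  occurrences (suc i) f xs ≡ occurrences i (tail ∘ f) xs
occurrences-suc i f xs = cong length (filter-≐ _ _ ((λ {x} → suc∈⇒∈tail (f x)) , (λ {x} → ∈tail⇒suc∈ (f x))) xs)
  where
  suc∈⇒∈tail : (v : Subset (suc _)) → suc i ∈ v → i ∈ tail v
  suc∈⇒∈tail (_ ∷ _) = drop-there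
  ∈tail⇒suc∈ : (v : Subset (suc _)) → i ∈ tail v → suc i ∈ v
  ∈tail⇒suc∈ (_ ∷ _) = there

∑∣∣≡occurrences-zero+∑∣tail∣ : ∀ {T : Set} {n} (f : T → Subset (suc n)) (xs : List T) →
  sum (map (λ x → ∣ f x ∣) xs) ≡ occurrences zero f xs + sum (map (λ x → ∣ tail (f x) ∣) xs)
∑∣∣≡occurrences-zero+∑∣tail∣ f []       = refl
∑∣∣≡occurrences-zero+∑∣tail∣ f (x ∷ xs) with f x | ∑∣∣≡occurrences-zero+∑∣tail∣ f xs
... | true  ∷ p | ih = cong suc (trans (cong (∣ p ∣ +_) ih) (+-leftComm ∣ p ∣ (occurrences zero f xs) _))
... | false ∷ p | ih = trans (cong (∣ p ∣ +_) ih) (+-leftComm ∣ p ∣ (occurrences zero f xs) _)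

∑∣∣-mono-occurrences : ∀ {T : Set} {n} (f g : T → Subset n) (xs : List T) →
                       (∀ i → occurrences i f xs ≤ occurrences i g xs) →
                       sum (map (λ x → ∣ f x ∣) xs) ≤ sum (map (λ x → ∣ g x ∣) xs)
∑∣∣-mono-occurrences {n = zero}  f g xs _      = sum-map-mono-≤ xs (λ x → ≤-trans (∣p∣≤n (f x)) z≤n)
∑∣∣-mono-occurrences {n = suc n} f g xs occ≤ = begin
  sum (map (λ x → ∣ f x ∣) xs)                                  ≡⟨ ∑∣∣≡occurrences-zero+∑∣tail∣ f xs ⟩
  occurrences zero f xs + sum (map (λ x → ∣ tail (f x) ∣) xs)   ≤⟨ +-mono-≤ (occ≤ zero) tails≤ ⟩
  occurrences zero g xs + sum (map (λ x → ∣ tail (g x) ∣) xs)   ≡⟨ sym (∑∣∣≡occurrences-zero+∑∣tail∣ g xs) ⟩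
  sum (map (λ x → ∣ g x ∣) xs)                                  ∎
  where
  open ≤-Reasoning
  tails≤ : sum (map (λ x → ∣ tail (f x) ∣) xs) ≤ sum (map (λ x → ∣ tail (g x) ∣) xs)
  tails≤ = ∑∣∣-mono-occurrences (tail ∘ f) (tail ∘ g) xs
             (λ i → subst₂ _≤_ (occurrences-suc i f xs) (occurrences-suc i g xs) (occ≤ (suc i)))

-- Kraft's inequality for disjoint subcubes

-- (L , R) stands for the subcube {S : L ⊆ S, S ∩ R = ∅} of the cube of all subsets of Fin n.
SubCube : ℕ → Set
SubCube n = Subset n × Subset n

Proper : ∀ {n} → SubCube n → Set
Proper (L , R) = ∀ {i} → i ∈ L → i ∉ R

dim codim : ∀ {n} → SubCube n → ℕ
dim   (L , R) = ∣ ∁ (L ∪ R) ∣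
codim (L , R) = ∣ L ∣ + ∣ R ∣

volume : ∀ {n} → SubCube n → ℕ
volume c = 2 ^ dim c

Separated : ∀ {n} → SubCube n → SubCube n → Set
Separated (L , R) (L′ , R′) = ∃ λ i → (i ∈ L × i ∈ R′) ⊎ (i ∈ L′ × i ∈ R)

proper-tail : ∀ {n l r} {L R : Subset n} → Proper (l ∷ L , r ∷ R) → Proper (L , R)
proper-tail proper i∈L i∈R = proper (there i∈L) (there i∈R)

dim+codim≡n : ∀ {n} (c : SubCube n) → Proper c → dim c + codim c ≡ n
dim+codim≡n ([]        , [])        _      = refl
dim+codim≡n (false ∷ L , false ∷ R) proper = cong suc (dim+codim≡n (L , R) (proper-tail proper))
dim+codim≡n (false ∷ L , true ∷ R)  proper =
  trans (cong (dim (L , R) +_) (+-suc ∣ L ∣ ∣ R ∣)) (trans (+-suc _ _) (cong suc (dim+codim≡n (L , R) (proper-tail proper))))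
dim+codim≡n (true ∷ L  , false ∷ R) proper = trans (+-suc _ _) (cong suc (dim+codim≡n (L , R) (proper-tail proper)))
dim+codim≡n (true ∷ L  , true ∷ R)  proper = contradiction here (proper here)

-- slice₀ / slice₁: the subcubes meeting the facet {S : 0 ∉ S} / {S : 0 ∈ S}, restricted to the other coordinates
slice₀ slice₁ : ∀ {n} → List (SubCube (suc n)) → List (SubCube n)
slice₀ []                         = []
slice₀ ((false ∷ L , _ ∷ R) ∷ cs) = (L , R) ∷ slice₀ cs
slice₀ ((true ∷ _ , _ ∷ _) ∷ cs)  = slice₀ cs
slice₁ []                         = []
slice₁ ((_ ∷ L , false ∷ R) ∷ cs) = (L , R) ∷ slice₁ cs
slice₁ ((_ ∷ _ , true ∷ _) ∷ cs)  = slice₁ cs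

∑volume≡∑volume-slices : ∀ {n} (cs : List (SubCube (suc n))) → All Proper cs →
  sum (map volume cs) ≡ sum (map volume (slice₀ cs)) + sum (map volume (slice₁ cs))
∑volume≡∑volume-slices [] [] = refl
∑volume≡∑volume-slices ((false ∷ L , false ∷ R) ∷ cs) (_ ∷ proper) =
  trans (cong₂ _+_ (cong (volume (L , R) +_) (+-identityʳ (volume (L , R)))) (∑volume≡∑volume-slices cs proper))
        (+-interchange (volume (L , R)) _ _ _)
∑volume≡∑volume-slices ((false ∷ L , true ∷ R) ∷ cs) (_ ∷ proper) =
  trans (cong (volume (L , R) +_) (∑volume≡∑volume-slices cs proper)) (sym (+-assoc (volume (L , R)) _ _))
∑volume≡∑volume-slices ((true ∷ L , false ∷ R) ∷ cs) (_ ∷ proper) =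
  trans (cong (volume (L , R) +_) (∑volume≡∑volume-slices cs proper)) (+-leftComm (volume (L , R)) (sum (map volume (slice₀ cs))) _)
∑volume≡∑volume-slices ((true ∷ L , true ∷ R) ∷ cs) (proper ∷ _) = contradiction here (proper here)

slice₀-Proper : ∀ {n} (cs : List (SubCube (suc n))) → All Proper cs → All Proper (slice₀ cs)
slice₀-Proper []                         []                 = []
slice₀-Proper ((false ∷ _ , _ ∷ _) ∷ cs) (proper ∷ propers) = proper-tail proper ∷ slice₀-Proper cs propers
slice₀-Proper ((true ∷ _ , _ ∷ _) ∷ cs)  (_ ∷ propers)      = slice₀-Proper cs propers

slice₁-Proper : ∀ {n} (cs : List (SubCube (suc n))) → All Proper cs → All Proper (slice₁ cs)
slice₁-Proper []                         []                 = []
slice₁-Proper ((_ ∷ _ , false ∷ _) ∷ cs) (proper ∷ propers) = proper-tail proper ∷ slice₁-Proper cs propers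
slice₁-Proper ((_ ∷ _ , true ∷ _) ∷ cs)  (_ ∷ propers)      = slice₁-Proper cs propers

separated-tail₀ : ∀ {n r r′} {L R L′ R′ : Subset n} →
  Separated (false ∷ L , r ∷ R) (false ∷ L′ , r′ ∷ R′) → Separated (L , R) (L′ , R′)
separated-tail₀ (suc i , inj₁ (there i∈L , there i∈R′)) = i , inj₁ (i∈L , i∈R′)
separated-tail₀ (suc i , inj₂ (there i∈L′ , there i∈R)) = i , inj₂ (i∈L′ , i∈R)

separated-tail₁ : ∀ {n l l′} {L R L′ R′ : Subset n} →
  Separated (l ∷ L , false ∷ R) (l′ ∷ L′ , false ∷ R′) → Separated (L , R) (L′ , R′)
separated-tail₁ (suc i , inj₁ (there i∈L , there i∈R′)) = i , inj₁ (i∈L , i∈R′)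
separated-tail₁ (suc i , inj₂ (there i∈L′ , there i∈R)) = i , inj₂ (i∈L′ , i∈R)

slice₀-Separated : ∀ {n r} {L R : Subset n} (cs : List (SubCube (suc n))) →
  All (Separated (false ∷ L , r ∷ R)) cs → All (Separated (L , R)) (slice₀ cs)
slice₀-Separated []                         []           = []
slice₀-Separated ((false ∷ _ , _ ∷ _) ∷ cs) (sep ∷ seps) = separated-tail₀ sep ∷ slice₀-Separated cs seps
slice₀-Separated ((true ∷ _ , _ ∷ _) ∷ cs)  (_ ∷ seps)   = slice₀-Separated cs seps

slice₁-Separated : ∀ {n l} {L R : Subset n} (cs : List (SubCube (suc n))) →
  All (Separated (l ∷ L , false ∷ R)) cs → All (Separated (L , R)) (slice₁ cs)
slice₁-Separated []                         []           = []
slice₁-Separated ((_ ∷ _ , false ∷ _) ∷ cs) (sep ∷ seps) = separated-tail₁ sep ∷ slice₁-Separated cs seps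
slice₁-Separated ((_ ∷ _ , true ∷ _) ∷ cs)  (_ ∷ seps)   = slice₁-Separated cs seps

slice₀-AllPairs : ∀ {n} (cs : List (SubCube (suc n))) → AllPairs Separated cs → AllPairs Separated (slice₀ cs)
slice₀-AllPairs []                         []           = []
slice₀-AllPairs ((false ∷ _ , _ ∷ _) ∷ cs) (seps ∷ ps) = slice₀-Separated cs seps ∷ slice₀-AllPairs cs ps
slice₀-AllPairs ((true ∷ _ , _ ∷ _) ∷ cs)  (_ ∷ ps)    = slice₀-AllPairs cs ps

slice₁-AllPairs : ∀ {n} (cs : List (SubCube (suc n))) → AllPairs Separated cs → AllPairs Separated (slice₁ cs)
slice₁-AllPairs []                         []           = []
slice₁-AllPairs ((_ ∷ _ , false ∷ _) ∷ cs) (seps ∷ ps) = slice₁-Separated cs seps ∷ slice₁-AllPairs cs ps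
slice₁-AllPairs ((_ ∷ _ , true ∷ _) ∷ cs)  (_ ∷ ps)    = slice₁-AllPairs cs ps

kraft : ∀ {n} (cs : List (SubCube n)) → All Proper cs → AllPairs Separated cs → sum (map volume cs) ≤ 2 ^ n
kraft {zero}  []                          _ _                       = z≤n
kraft {zero}  (([] , []) ∷ [])            _ _                       = ≤-refl
kraft {zero}  (([] , []) ∷ _ ∷ _)         _ (((() , _) ∷ _) ∷ _)
kraft {suc n} cs propers seps = begin
  sum (map volume cs)                                          ≡⟨ ∑volume≡∑volume-slices cs propers ⟩
  sum (map volume (slice₀ cs)) + sum (map volume (slice₁ cs))  ≤⟨ +-mono-≤ facet₀ facet₁ ⟩
  2 ^ n + 2 ^ n                                                ≡⟨ cong (2 ^ n +_) (sym (+-identityʳ (2 ^ n))) ⟩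
  2 ^ suc n                                                    ∎
  where
  open ≤-Reasoning
  facet₀ : sum (map volume (slice₀ cs)) ≤ 2 ^ n
  facet₀ = kraft (slice₀ cs) (slice₀-Proper cs propers) (slice₀-AllPairs cs seps)
  facet₁ : sum (map volume (slice₁ cs)) ≤ 2 ^ n
  facet₁ = kraft (slice₁ cs) (slice₁-Proper cs propers) (slice₁-AllPairs cs seps)

length^length≤2^∑codim : ∀ {n} (cs : List (SubCube n)) → All Proper cs → AllPairs Separated cs →
                         length cs ^ length cs ≤ 2 ^ sum (map codim cs)
length^length≤2^∑codim {n} cs propers seps =
  *-cancelʳ-≤ _ _ (2 ^ sum (map dim cs)) {{m^n≢0 2 (sum (map dim cs))}} (begin
    N ^ N * 2 ^ sum (map dim cs)                   ≡⟨ cong (N ^ N *_) (sym (product-map-^ 2 dim cs)) ⟩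
    N ^ N * product (map volume cs)                ≤⟨ amgm-map volume cs ⟩
    sum (map volume cs) ^ N                        ≤⟨ ^-monoˡ-≤ N (kraft cs propers seps) ⟩
    (2 ^ n) ^ N                                    ≡⟨ ^-*-assoc 2 n N ⟩
    2 ^ (n * N)                                    ≡⟨ cong (2 ^_) (trans (*-comm n N) (sym ∑dim+codim)) ⟩
    2 ^ (sum (map dim cs) + sum (map codim cs))    ≡⟨ ^-distribˡ-+-* 2 (sum (map dim cs)) (sum (map codim cs)) ⟩
    2 ^ sum (map dim cs) * 2 ^ sum (map codim cs)  ≡⟨ *-comm (2 ^ sum (map dim cs)) (2 ^ sum (map codim cs)) ⟩
    2 ^ sum (map codim cs) * 2 ^ sum (map dim cs)  ∎)
  where
  open ≤-Reasoning
  N : ℕ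
  N = length cs
  ∑dim+codim : sum (map dim cs) + sum (map codim cs) ≡ N * n
  ∑dim+codim = trans (sym (sum-map-+ dim codim cs)) (sum-map-const (All.map (λ {c} → dim+codim≡n c) propers))

x∈⋃⁻ : ∀ {n} (G : List (Subset n)) {x} → x ∈ ⋃ G → ∃ λ D → D ∈ₗ G × x ∈ D
x∈⋃⁻ []      x∈∅ = contradiction x∈∅ ∉⊥
x∈⋃⁻ (D ∷ G) {x} x∈⋃ with x∈p∪q⁻ D (⋃ G) x∈⋃
... | inj₁ x∈D  = D , here refl , x∈D
... | inj₂ x∈⋃G = let E , E∈G , x∈E = x∈⋃⁻ G x∈⋃G in E , there E∈G , x∈E

x∈⋃⁺ : ∀ {n} (G : List (Subset n)) {D x} → D ∈ₗ G → x ∈ D → x ∈ ⋃ G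
x∈⋃⁺ (D ∷ G) (here refl) x∈D = x∈p∪q⁺ (inj₁ x∈D)
x∈⋃⁺ (E ∷ G) (there D∈G) x∈D = x∈p∪q⁺ (inj₂ (x∈⋃⁺ G D∈G x∈D))

∪-least : ∀ {n} {p q r : Subset n} → p ⊆ r → q ⊆ r → p ∪ q ⊆ r
∪-least {p = p} {q} p⊆r q⊆r x∈p∪q = [ p⊆r , q⊆r ]′ (x∈p∪q⁻ p q x∈p∪q)

⊈⇒∃∉ : ∀ {n} {p q : Subset n} → ¬ p ⊆ q → ∃ λ x → x ∈ p × x ∉ q
⊈⇒∃∉ {n} {p} {q} p⊈q with ¬∀⟶∃¬ n (λ x → x ∈ p → x ∈ q) (λ x → (x ∈? p) →-dec (x ∈? q)) (λ p⊆q → p⊈q (p⊆q _))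
... | x , x∈p↛x∈q =
  x , decidable-stable (x ∈? p) (λ x∉p → x∈p↛x∈q (flip contradiction x∉p)) , (λ x∈q → x∈p↛x∈q (λ _ → x∈q))

⊆⇒≡⊎⊂ : ∀ {n} {p q : Subset n} → p ⊆ q → p ≡ q ⊎ p ⊂ q
⊆⇒≡⊎⊂ {p = p} {q} p⊆q with q ⊆? p
... | yes q⊆p = inj₁ (⊆-antisym p⊆q q⊆p)
... | no  q⊈p = inj₂ (p⊆q , ⊈⇒∃∉ q⊈p)

_≟ˢ_ : ∀ {n} → DecidableEquality (Subset n)
_≟ˢ_ = ≡-dec _≟ᵇ_

inject-fromℕ< : ∀ {n} {i j : Fin n} (i<j : toℕ i < toℕ j) → inject {i = j} (fromℕ< i<j) ≡ i
inject-fromℕ< i<j = toℕ-injective (trans (toℕ-inject (fromℕ< i<j)) (toℕ-fromℕ< i<j))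

-- Union-closed families

module UnionClosedFamily {m} {F : List (Subset m)} (union-closed : UnionClosed F) where

  ∪∈ : ∀ {A B} → A ∈ₗ F → B ∈ₗ F → A ∪ B ∈ₗ F
  ∪∈ = proj₂ union-closed

  ⋃∈ : ∀ G → G ≢ [] → (∀ {E} → E ∈ₗ G → E ∈ₗ F) → ⋃ G ∈ₗ F
  ⋃∈ []          G≢[] _    = contradiction refl G≢[]
  ⋃∈ (D ∷ [])    _    G⊆F = subst (_∈ₗ F) (sym (∪-identityʳ D)) (G⊆F (here refl))
  ⋃∈ (D ∷ E ∷ G) _    G⊆F = ∪∈ (G⊆F (here refl)) (⋃∈ (E ∷ G) (λ ()) (G⊆F ∘ there))

  ⋃∈∅∷F : ∀ G → (∀ {E} → E ∈ₗ G → E ∈ₗ F) → ⋃ G ∈ₗ ∅ ∷ F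
  ⋃∈∅∷F []      _   = here refl
  ⋃∈∅∷F (D ∷ G) G⊆F = there (⋃∈ (D ∷ G) (λ ()) G⊆F)

  avoiding : Fin m → List (Subset m)
  avoiding x = filter (λ D → ¬? (x ∈? D)) F

  maxAvoiding : Fin m → Subset m
  maxAvoiding x = ⋃ (avoiding x)

  ∉maxAvoiding : ∀ x → x ∉ maxAvoiding x
  ∉maxAvoiding x x∈ = let D , D∈ , x∈D = x∈⋃⁻ (avoiding x) x∈ in proj₂ (∈-filter⁻ (λ D → ¬? (x ∈? D)) {xs = F} D∈) x∈D

  ⊆maxAvoiding : ∀ {x D} → D ∈ₗ F → x ∉ D → D ⊆ maxAvoiding x
  ⊆maxAvoiding {x} D∈F x∉D = x∈⋃⁺ (avoiding x) (∈-filter⁺ (λ D → ¬? (x ∈? D)) D∈F x∉D)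

  maxAvoiding∈∅∷F : ∀ x → maxAvoiding x ∈ₗ ∅ ∷ F
  maxAvoiding∈∅∷F x = ⋃∈∅∷F (avoiding x) (proj₁ ∘ ∈-filter⁻ (λ D → ¬? (x ∈? D)) {xs = F})

  maxAvoiding-≡⇒∈ : ∀ {x y D} → maxAvoiding x ≡ maxAvoiding y → D ∈ₗ F → x ∈ D → y ∈ D
  maxAvoiding-≡⇒∈ {x} {y} {D} eq D∈F x∈D = decidable-stable (y ∈? D)
    (λ y∉D → ∉maxAvoiding x (subst (x ∈_) (sym eq) (⊆maxAvoiding D∈F y∉D x∈D)))

  -- X holds the least element of each class of ⋃ F under x ~ y ⇔ maxAvoiding x ≡ maxAvoiding y;
  -- no member of F separates two equivalent elements.
  Representative : Fin m → Set
  Representative x = x ∈ ⋃ F × ((j : Fin′ x) → maxAvoiding (inject j) ≢ maxAvoiding x)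

  representative? : Decidable Representative
  representative? x = (x ∈? ⋃ F) ×-dec allFin? (λ j → ¬? (maxAvoiding (inject j) ≟ˢ maxAvoiding x))

  X : Subset m
  X = fromPred representative?

  X⊆⋃F : X ⊆ ⋃ F
  X⊆⋃F = proj₁ ∘ ∈fromPred⁻ representative?

  representative : ∀ {y} → y ∈ ⋃ F → ∃ λ x → x ∈ X × maxAvoiding x ≡ maxAvoiding y
  representative {y} y∈⋃F
    with ¬∀⟶∃¬-smallest m (λ z → maxAvoiding z ≢ maxAvoiding y)
           (λ z → ¬? (maxAvoiding z ≟ˢ maxAvoiding y)) (λ all≢ → all≢ y refl)
  ... | x , ¬x≢y , below = x , ∈fromPred⁺ representative? (x∈⋃F , below′) , x≡y
    where
    x≡y : maxAvoiding x ≡ maxAvoiding y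
    x≡y = decidable-stable (maxAvoiding x ≟ˢ maxAvoiding y) ¬x≢y
    x∈⋃F : x ∈ ⋃ F
    x∈⋃F = let D , D∈F , y∈D = x∈⋃⁻ F y∈⋃F in x∈⋃⁺ F D∈F (maxAvoiding-≡⇒∈ (sym x≡y) D∈F y∈D)
    below′ : (j : Fin′ x) → maxAvoiding (inject j) ≢ maxAvoiding x
    below′ j = subst (maxAvoiding (inject j) ≢_) (sym x≡y) (below j)

  X-least : ∀ {x x′} → x′ ∈ X → toℕ x < toℕ x′ → maxAvoiding x ≢ maxAvoiding x′
  X-least x′∈X x<x′ =
    subst (λ z → maxAvoiding z ≢ _) (inject-fromℕ< x<x′) (proj₂ (∈fromPred⁻ representative? x′∈X) (fromℕ< x<x′))

  maxAvoiding-injectiveOn-X : ∀ {x x′} → x ∈ X → x′ ∈ X → maxAvoiding x ≡ maxAvoiding x′ → x ≡ x′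
  maxAvoiding-injectiveOn-X {x} {x′} x∈X x′∈X eq with <-cmp (toℕ x) (toℕ x′)
  ... | tri< x<x′ _ _ = contradiction eq (X-least x′∈X x<x′)
  ... | tri≈ _ x≡x′ _ = toℕ-injective x≡x′
  ... | tri> _ _ x′<x = contradiction (sym eq) (X-least x∈X x′<x)

  ∣X∣≤length : F ≢ [] → ∣ X ∣ ≤ length F
  ∣X∣≤length F≢[] = begin
    ∣ X ∣                            ≡⟨ ∣p∣≡length-filter-allFin X ⟩
    length (filter (_∈? X) (allFin m)) ≤⟨ length-≤-injection targets maxAvoiding (filter⁺ (_∈? X) (allFin⁺ m)) maps-to injective ⟩
    length targets                   ≤⟨ filter-notAll (λ D → ¬? (D ≟ˢ ⋃ F)) F (lose (⋃∈ F F≢[] id) (contradiction refl)) ⟩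
    length F                         ∎
    where
    open ≤-Reasoning
    -- maxAvoiding x is never ⋃ F itself
    targets : List (Subset m)
    targets = ∅ ∷ filter (λ D → ¬? (D ≟ˢ ⋃ F)) F
    enumerated⇒∈X : ∀ {x} → x ∈ₗ filter (_∈? X) (allFin m) → x ∈ X
    enumerated⇒∈X = proj₂ ∘ ∈-filter⁻ (_∈? X) {xs = allFin m}
    maps-to : ∀ {x} → x ∈ₗ filter (_∈? X) (allFin m) → maxAvoiding x ∈ₗ targets
    maps-to {x} x∈ with maxAvoiding∈∅∷F x
    ... | here  eq  = here eq
    ... | there D∈F = there (∈-filter⁺ (λ D → ¬? (D ≟ˢ ⋃ F)) D∈F
                        (λ eq → ∉maxAvoiding x (subst (x ∈_) (sym eq) (X⊆⋃F (enumerated⇒∈X x∈)))))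
    injective : ∀ {x x′} → x ∈ₗ filter (_∈? X) (allFin m) → x′ ∈ₗ filter (_∈? X) (allFin m) →
                maxAvoiding x ≡ maxAvoiding x′ → x ≡ x′
    injective x∈ x′∈ = maxAvoiding-injectiveOn-X (enumerated⇒∈X x∈) (enumerated⇒∈X x′∈)

  X-separates : ∀ {A C} → A ∈ₗ F → C ∈ₗ F → A ⊂ C → ∃ λ y → y ∈ X × y ∈ C × y ∉ A
  X-separates A∈F C∈F (_ , z , z∈C , z∉A) with representative (x∈⋃⁺ F C∈F z∈C)
  ... | y , y∈X , y~z = y , y∈X , maxAvoiding-≡⇒∈ (sym y~z) C∈F z∈C , z∉A ∘ maxAvoiding-≡⇒∈ y~z A∈F

  infix 4 _⋖_ _⋖?_
  _⋖_ : Subset m → Subset m → Set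
  A ⋖ C = A ⊂ C × All (λ E → A ⊂ E → ¬ E ⊂ C) F

  _⋖?_ : ∀ A C → Dec (A ⋖ C)
  A ⋖? C = (A ⊂? C) ×-dec all? (λ E → (A ⊂? E) →-dec ¬? (E ⊂? C)) F

  ⋖-below : ∀ {A D} → D ∈ₗ F → A ⊂ D → ∃ λ C → C ∈ₗ F × A ⋖ C × C ⊆ D
  ⋖-below {A} {D} = go (⊂-wellFounded D)
    where
    go : ∀ {D} → Acc _⊂_ D → D ∈ₗ F → A ⊂ D → ∃ λ C → C ∈ₗ F × A ⋖ C × C ⊆ D
    go {D} (acc smaller) D∈F A⊂D with any? (λ E → (A ⊂? E) ×-dec (E ⊂? D)) F
    ... | yes between =
      let E , E∈F , A⊂E , E⊂D = find between
          C , C∈F , A⋖C , C⊆E = go (smaller E⊂D) E∈F A⊂E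
      in C , C∈F , A⋖C , ⊆-trans C⊆E (proj₁ E⊂D)
    ... | no ¬between = D , D∈F , (A⊂D , All.tabulate (λ E∈F A⊂E E⊂D → ¬between (lose E∈F (A⊂E , E⊂D)))) , ⊆-refl

  ⋖-maximal : ∀ {A B C} → A ⋖ C → B ∈ₗ F → A ⊆ B → B ⊂ C → B ⊆ A
  ⋖-maximal (_ , nothing-between) B∈F A⊆B B⊂C with ⊆⇒≡⊎⊂ A⊆B
  ... | inj₁ A≡B = ⊆-reflexive (sym A≡B)
  ... | inj₂ A⊂B = contradiction B⊂C (All.lookup nothing-between B∈F A⊂B)

  -- If A and A′ are both covered by C and y ∈ C lies in neither, then A ∪ A′ lies strictly between.
  ⋖-injective : ∀ {A A′ C y} → A ∈ₗ F → A′ ∈ₗ F → A ⋖ C → A′ ⋖ C → y ∈ C → y ∉ A → y ∉ A′ → A ≡ A′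
  ⋖-injective {A} {A′} {C} {y} A∈F A′∈F A⋖C A′⋖C y∈C y∉A y∉A′ =
    ⊆-antisym (⊆-trans (p⊆p∪q A′) (⋖-maximal A′⋖C A∪A′∈F (q⊆p∪q A A′) A∪A′⊂C))
              (⊆-trans (q⊆p∪q A A′) (⋖-maximal A⋖C A∪A′∈F (p⊆p∪q A′) A∪A′⊂C))
    where
    A∪A′∈F : A ∪ A′ ∈ₗ F
    A∪A′∈F = ∪∈ A∈F A′∈F
    A∪A′⊂C : A ∪ A′ ⊂ C
    A∪A′⊂C = ∪-least (proj₁ (proj₁ A⋖C)) (proj₁ (proj₁ A′⋖C)) , y , y∈C , [ y∉A , y∉A′ ]′ ∘ x∈p∪q⁻ A A′

  coverContaining? : ∀ A y → Decidable (λ C → A ⋖ C × y ∈ C)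
  coverContaining? A y C = (A ⋖? C) ×-dec (y ∈? C)

  gained : Subset m → Subset m
  gained A = fromPred (λ y → (y ∈? X) ×-dec ¬? (y ∈? A) ×-dec any? (coverContaining? A y) F)

  cube : Subset m → SubCube m
  cube A = A ∩ X , gained A

  cube-proper : ∀ A → Proper (cube A)
  cube-proper A y∈A∩X y∈gained = proj₁ (proj₂ (∈fromPred⁻ _ y∈gained)) (proj₁ (x∈p∩q⁻ A X y∈A∩X))

  gained-meets : ∀ {A A′ D} → A ∈ₗ F → D ∈ₗ F → A ⊂ D → D ⊆ A ∪ A′ → ∃ λ y → y ∈ gained A × y ∈ A′ ∩ X
  gained-meets {A} {A′} A∈F D∈F A⊂D D⊆A∪A′ =
    let C , C∈F , A⋖C , C⊆D = ⋖-below D∈F A⊂D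
        y , y∈X , y∈C , y∉A = X-separates A∈F C∈F (proj₁ A⋖C)
        y∈A′ = [ flip contradiction y∉A , id ]′ (x∈p∪q⁻ A A′ (D⊆A∪A′ (C⊆D y∈C)))
    in y , ∈fromPred⁺ _ (y∈X , y∉A , lose C∈F (A⋖C , y∈C)) , x∈p∩q⁺ (y∈A′ , y∈X)

  cube-separated : ∀ {A A′} → A ∈ₗ F → A′ ∈ₗ F → A ≢ A′ → Separated (cube A) (cube A′)
  cube-separated {A} {A′} A∈F A′∈F A≢A′ with A′ ⊆? A
  ... | yes A′⊆A with ⊆⇒≡⊎⊂ A′⊆A
  ...   | inj₁ A′≡A = contradiction (sym A′≡A) A≢A′
  ...   | inj₂ A′⊂A = let y , y∈gained , y∈A∩X = gained-meets A′∈F A∈F A′⊂A (q⊆p∪q A′ A)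
                      in y , inj₁ (y∈A∩X , y∈gained)
  cube-separated {A} {A′} A∈F A′∈F A≢A′ | no A′⊈A =
    let z , z∈A′ , z∉A = ⊈⇒∃∉ A′⊈A
        y , y∈gained , y∈A′∩X = gained-meets A∈F (∪∈ A∈F A′∈F) (p⊆p∪q A′ , z , x∈p∪q⁺ (inj₂ z∈A′) , z∉A) ⊆-refl
    in y , inj₂ (y∈A′∩X , y∈gained)

  someCover : Subset m → Fin m → Subset m
  someCover A y with any? (coverContaining? A y) F
  ... | yes ∃C = proj₁ (find ∃C)
  ... | no  _  = A

  ∈gained⇒someCover : ∀ {A y} → y ∈ gained A →
    y ∈ X × y ∉ A × someCover A y ∈ₗ F × A ⋖ someCover A y × y ∈ someCover A y
  ∈gained⇒someCover {A} {y} y∈gained with ∈fromPred⁻ _ y∈gained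
  ... | y∈X , y∉A , ∃C with any? (coverContaining? A y) F
  ...   | yes ∃C′ = y∈X , y∉A , proj₂ (find ∃C′)
  ...   | no ¬∃C  = contradiction ∃C ¬∃C

  occurrences-gained≤occurrences-∩X : ∀ y → occurrences y gained F ≤ occurrences y (_∩ X) F
  occurrences-gained≤occurrences-∩X y =
    length-≤-injection (filter (λ A → y ∈? A ∩ X) F) (λ A → someCover A y)
      (filter⁺ (λ A → y ∈? gained A) (proj₁ union-closed)) maps-to injective
    where
    gaining : ∀ {A} → A ∈ₗ filter (λ A → y ∈? gained A) F → A ∈ₗ F × y ∈ gained A
    gaining = ∈-filter⁻ (λ A → y ∈? gained A) {xs = F}
    maps-to : ∀ {A} → A ∈ₗ filter (λ A → y ∈? gained A) F → someCover A y ∈ₗ filter (λ A → y ∈? A ∩ X) F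
    maps-to A∈ with ∈gained⇒someCover (proj₂ (gaining A∈))
    ... | y∈X , _ , C∈F , _ , y∈C = ∈-filter⁺ (λ A → y ∈? A ∩ X) C∈F (x∈p∩q⁺ (y∈C , y∈X))
    injective : ∀ {A A′} → A ∈ₗ filter (λ A → y ∈? gained A) F → A′ ∈ₗ filter (λ A → y ∈? gained A) F →
                someCover A y ≡ someCover A′ y → A ≡ A′
    injective {A} {A′} A∈ A′∈ same with ∈gained⇒someCover (proj₂ (gaining A∈)) | ∈gained⇒someCover (proj₂ (gaining A′∈))
    ... | _ , y∉A , _ , A⋖C , y∈C | _ , y∉A′ , _ , A′⋖C′ , _ =
      ⋖-injective (proj₁ (gaining A∈)) (proj₁ (gaining A′∈)) A⋖C (subst (A′ ⋖_) (sym same) A′⋖C′) y∈C y∉A y∉A′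

  length^length≤4^∑∣∩X∣ : length F ^ length F ≤ 4 ^ sum (map (λ A → ∣ A ∩ X ∣) F)
  length^length≤4^∑∣∩X∣ = begin
    length F ^ length F           ≡⟨ cong (λ k → k ^ k) (sym (length-map cube F)) ⟩
    length cubes ^ length cubes   ≤⟨ length^length≤2^∑codim cubes (All-map⁺ (All.universal cube-proper F)) separated ⟩
    2 ^ sum (map codim cubes)     ≡⟨ cong (λ cs → 2 ^ sum cs) (sym (map-∘ {g = codim} {f = cube} F)) ⟩
    2 ^ sum (map (codim ∘ cube) F) ≡⟨ cong (2 ^_) (sum-map-+ (λ A → ∣ A ∩ X ∣) (λ A → ∣ gained A ∣) F) ⟩
    2 ^ (s∩X + s-gained)          ≤⟨ ^-monoʳ-≤ 2 (+-monoʳ-≤ s∩X charged) ⟩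
    2 ^ (s∩X + s∩X)               ≡⟨ cong (λ k → 2 ^ (s∩X + k)) (sym (+-identityʳ s∩X)) ⟩
    2 ^ (2 * s∩X)                 ≡⟨ sym (^-*-assoc 2 2 s∩X) ⟩
    4 ^ s∩X                       ∎
    where
    open ≤-Reasoning
    cubes : List (SubCube m)
    cubes = map cube F
    separated : AllPairs Separated cubes
    separated = AllPairs-map⁺ (AllPairs-mapWith∈ cube-separated (proj₁ union-closed))
    s∩X s-gained : ℕ
    s∩X = sum (map (λ A → ∣ A ∩ X ∣) F)
    s-gained = sum (map (λ A → ∣ gained A ∣) F)
    charged : s-gained ≤ s∩X
    charged = ∑∣∣-mono-occurrences gained (_∩ X) F occurrences-gained≤occurrences-∩X

  ∣⋃F∣≤length+∑∣∩∁X∣ : F ≢ [] → ∣ ⋃ F ∣ ≤ length F + sum (map (λ A → ∣ A ∩ ∁ X ∣) F)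
  ∣⋃F∣≤length+∑∣∩∁X∣ F≢[] = begin
    ∣ ⋃ F ∣                          ≡⟨ ∣p∣≡∣p∩q∣+∣p∩∁q∣ (⋃ F) X ⟩
    ∣ ⋃ F ∩ X ∣ + ∣ ⋃ F ∩ ∁ X ∣      ≤⟨ +-mono-≤ (≤-trans (∣p∩q∣≤∣q∣ (⋃ F) X) (∣X∣≤length F≢[]))
                                                 (∈⇒≤sum-map (λ A → ∣ A ∩ ∁ X ∣) (⋃∈ F F≢[] id)) ⟩
    length F + sum (map (λ A → ∣ A ∩ ∁ X ∣) F) ∎
    where open ≤-Reasoning

totalSize≡∑∣∣ : ∀ {m} (F : List (Subset m)) → totalSize F ≡ sum (map ∣_∣ F)
totalSize≡∑∣∣ []      = refl
totalSize≡∑∣∣ (A ∷ F) = cong (∣ A ∣ +_) (totalSize≡∑∣∣ F)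

-- The bound holds for n = 0 as well.
theorem3 : ∀ (n m : ℕ) (F : List (Subset m)) → UnionClosed F → ∣ bigUnion F ∣ ≡ n → 1 ≤ n →
               n ^ length F ≤ 2 ^ (2 * totalSize F)
theorem3 n m []        _            _    _ = ≤-refl
theorem3 n m F@(_ ∷ _) union-closed refl _ = begin
  ∣ ⋃ F ∣ ^ N                ≤⟨ ^-monoˡ-≤ N (∣⋃F∣≤length+∑∣∩∁X∣ (λ ())) ⟩
  (N + s∩∁X) ^ N             ≤⟨ [m+n]^m≤m^m*4^n N s∩∁X ⟩
  N ^ N * 4 ^ s∩∁X           ≤⟨ *-monoˡ-≤ (4 ^ s∩∁X) length^length≤4^∑∣∩X∣ ⟩
  4 ^ s∩X * 4 ^ s∩∁X         ≡⟨ sym (^-distribˡ-+-* 4 s∩X s∩∁X) ⟩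
  4 ^ (s∩X + s∩∁X)           ≡⟨ cong (4 ^_) (sym (trans (totalSize≡∑∣∣ F) (∑∣∣≡∑∣∩∣+∑∣∩∁∣ X F))) ⟩
  4 ^ totalSize F            ≡⟨ ^-*-assoc 2 2 (totalSize F) ⟩
  2 ^ (2 * totalSize F)      ∎
  where
  open ≤-Reasoning
  open UnionClosedFamily union-closed
  N s∩X s∩∁X : ℕ
  N    = length F
  s∩X  = sum (map (λ A → ∣ A ∩ X ∣) F)
  s∩∁X = sum (map (λ A → ∣ A ∩ ∁ X ∣) F)
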